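{- Let $S^{(0)}$ be an extraTrib. There is no infinite sequence $S^{(0)},S^{(1)},S^{(2)},\dots$ of extraTribs such that, for every $k\ge0$, $S^{(k)}$ is the difference sequence of $S^{(k+1)}$. In other words, repeatedly taking extraTrib difference-inverses starting from $S^{(0)}$ reaches, after finitely many steps, an extraTrib that is not the difference sequence of any extraTrib.
   Context: A two-sided integer sequence $(X_i)_{i\in\mathbb Z}$ is an extraTrib if $X_i=X_{i-1}+X_{i-2}+X_{i-3}$ for all $i$ and $X_i>0$ for all sufficiently large $i$. The difference sequence of $X$ is $(X_{i+1}-X_i)_{i\in\mathbb Z}$. -}

module Defs where

open import Data.Integer using (ℤ; +_; _+_; _-_; _≥_; _>_; 0ℤ; 1ℤ)
open import Data.Product using (Σ; _×_)
open import Relation.Binary.PropositionalEquality using (_≡_)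

Seq : Set
Seq = ℤ → ℤ

TribRec : Seq → Set
TribRec X = ∀ (i : ℤ) → X i ≡ X (i - 1ℤ) + X (i - + 2) + X (i - + 3)

EventuallyPositive : Seq → Set
EventuallyPositive X = Σ ℤ (λ N → ∀ (i : ℤ) → i ≥ N → X i > 0ℤ)

ExtraTrib : Seq → Set
ExtraTrib X = TribRec X × EventuallyPositive X

diff : Seq → Seq
diff X i = X (i + 1ℤ) - X i

-- The third difference of a Tribonacci-type sequence Y is Δ³Y(i) = 2 (2 Y(i+1) − Y(i+2)),
-- always even. In a tower S⁰, S¹, … of extraTribs with Sᵏ = Δ Sᵏ⁺¹ we have
-- Sᵏ = Δ³ Sᵏ⁺³, so by induction every entry of every Sᵏ is divisible by 2ⁿ for
-- every n, hence zero; but S⁰ is eventually positive.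
module Submission where

open import Defs
open import Data.Nat using (ℕ; zero; suc)
open import Data.Integer using (ℤ)
open import Data.Product using (Σ; _×_)
open import Relation.Nullary using (¬_)
open import Relation.Binary.PropositionalEquality using (_≡_)

import Data.Nat as ℕ
import Data.Nat.Properties as ℕ
import Data.Nat.Divisibility as ℕ
open import Data.Integer using (+_; +0; +[1+_]; -[1+_]; _+_; _-_; _*_; 0ℤ; 1ℤ)
open import Data.Integer.Properties using (pos-*; *-identityʳ; <⇒≢; ≤-refl)
open import Data.Integer.Divisibility.Signed
  using (_∣_; divides; ∣⇒∣ᵤ; ∣m∣n⇒∣m-n; ∣n⇒∣m*n; *-monoʳ-∣)
open import Data.Integer.Tactic.RingSolver using (solve-∀)
open import Data.Product using (_,_; proj₁)
open import Relation.Nullary using (contradiction)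
open import Relation.Binary.PropositionalEquality
  using (_≗_; refl; sym; trans; cong; cong₂; subst₂; module ≡-Reasoning)

n<2^n : ∀ n → n ℕ.< 2 ℕ.^ n
n<2^n zero    = ℕ.s≤s ℕ.z≤n
n<2^n (suc n) = ℕ.+-mono-≤-< (ℕ.m^n>0 2 n) (subst₂ ℕ._<_ refl (sym (ℕ.+-identityʳ _)) (n<2^n n))

∀2^n∣⇒≡0 : ∀ {x} → (∀ n → + (2 ℕ.^ n) ∣ x) → x ≡ 0ℤ
∀2^n∣⇒≡0 {+0}       _     = refl
∀2^n∣⇒≡0 {+[1+ m ]} 2^n∣x = contradiction (∣⇒∣ᵤ (2^n∣x (suc m))) (ℕ.>⇒∤ (n<2^n (suc m)))
∀2^n∣⇒≡0 { -[1+ m ]} 2^n∣x = contradiction (∣⇒∣ᵤ (2^n∣x (suc m))) (ℕ.>⇒∤ (n<2^n (suc m)))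

diff-cong : ∀ {X Y} → X ≗ Y → diff X ≗ diff Y
diff-cong X≗Y i = cong₂ _-_ (X≗Y (i + 1ℤ)) (X≗Y i)

TribRec⇒forward : ∀ {Y} → TribRec Y → ∀ i → Y (i + 1ℤ + 1ℤ + 1ℤ) ≡ Y (i + 1ℤ + 1ℤ) + Y (i + 1ℤ) + Y i
TribRec⇒forward {Y} rec i = trans (rec (i + 1ℤ + 1ℤ + 1ℤ))
  (cong₂ _+_ (cong₂ _+_ (cong Y (back₁ i)) (cong Y (back₂ i))) (cong Y (back₃ i)))
  where
  back₁ : ∀ i → i + 1ℤ + 1ℤ + 1ℤ - 1ℤ ≡ i + 1ℤ + 1ℤ
  back₁ = solve-∀
  back₂ : ∀ i → i + 1ℤ + 1ℤ + 1ℤ - + 2 ≡ i + 1ℤ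
  back₂ = solve-∀
  back₃ : ∀ i → i + 1ℤ + 1ℤ + 1ℤ - + 3 ≡ i
  back₃ = solve-∀

diff³-TribRec : ∀ {Y} → TribRec Y →
  ∀ i → diff (diff (diff Y)) i ≡ + 2 * (+ 2 * Y (i + 1ℤ) - Y (i + 1ℤ + 1ℤ))
diff³-TribRec {Y} rec i = begin
  diff (diff (diff Y)) i
    ≡⟨ cong (λ y₃ → ((y₃ - y₂) - (y₂ - y₁)) - ((y₂ - y₁) - (y₁ - y₀))) (TribRec⇒forward rec i) ⟩
  ((y₂ + y₁ + y₀ - y₂) - (y₂ - y₁)) - ((y₂ - y₁) - (y₁ - y₀))
    ≡⟨ third-difference y₀ y₁ y₂ ⟩
  + 2 * (+ 2 * y₁ - y₂) ∎
  where
  open ≡-Reasoning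
  y₀ = Y i
  y₁ = Y (i + 1ℤ)
  y₂ = Y (i + 1ℤ + 1ℤ)
  third-difference : ∀ a b c → ((c + b + a - c) - (c - b)) - ((c - b) - (b - a)) ≡ + 2 * (+ 2 * b - c)
  third-difference = solve-∀

module DifferenceTower (S : ℕ → Seq)
                       (trib : ∀ k → TribRec (S k))
                       (S≗diff : ∀ k → S k ≗ diff (S (suc k))) where

  S≗diff³ : ∀ k → S k ≗ diff (diff (diff (S (3 ℕ.+ k))))
  S≗diff³ k i = trans (S≗diff k i)
    (diff-cong (λ j → trans (S≗diff (1 ℕ.+ k) j) (diff-cong (S≗diff (2 ℕ.+ k)) j)) i)

  2^n∣S : ∀ n k i → + (2 ℕ.^ n) ∣ S k i
  2^n∣S zero    k i = divides (S k i) (sym (*-identityʳ (S k i)))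
  2^n∣S (suc n) k i = subst₂ _∣_ (sym (pos-* 2 (2 ℕ.^ n))) (sym S≡2[2a-b])
    (*-monoʳ-∣ (+ 2) (∣m∣n⇒∣m-n (∣n⇒∣m*n (+ 2) (2^n∣S n (3 ℕ.+ k) (i + 1ℤ)))
                                (2^n∣S n (3 ℕ.+ k) (i + 1ℤ + 1ℤ))))
    where
    S≡2[2a-b] : S k i ≡ + 2 * (+ 2 * S (3 ℕ.+ k) (i + 1ℤ) - S (3 ℕ.+ k) (i + 1ℤ + 1ℤ))
    S≡2[2a-b] = trans (S≗diff³ k i) (diff³-TribRec (trib (3 ℕ.+ k)) i)

  S≡0 : ∀ k i → S k i ≡ 0ℤ
  S≡0 k i = ∀2^n∣⇒≡0 (λ n → 2^n∣S n k i)

mainTheorem9 : (S₀ : Seq) → ExtraTrib S₀ →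
    ¬ (Σ (ℕ → Seq) (λ S →
    (∀ (i : ℤ) → S zero i ≡ S₀ i) ×
    (∀ (k : ℕ) → ExtraTrib (S k)) ×
    (∀ (k : ℕ) (i : ℤ) → S k i ≡ diff (S (suc k)) i)))
mainTheorem9 S₀ (_ , N , S₀-pos) (S , S₀≗ , extra , S≗diff) =
  <⇒≢ (S₀-pos N ≤-refl) (sym S₀N≡0)
  where
  open DifferenceTower S (λ k → proj₁ (extra k)) S≗diff
  S₀N≡0 : S₀ N ≡ 0ℤ
  S₀N≡0 = trans (sym (S₀≗ N)) (S≡0 zero N)
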